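{- Every instance of 3DSMI of dimension $n\leqslant 2$ has a stable matching.
   Context: An instance of 3DSMI of dimension $n$ is a directed graph $G$ without multiple edges whose vertex set $V$ is partitioned into three sets $M$, $F$, $D$ with $|M|=|F|=|D|=n$, such that every edge goes from $M$ to $F$, from $F$ to $D$, or from $D$ to $M$. Each edge $(v,v')$ carries a positive integer rank $r(v,v')$ such that, for every vertex $v$ of out-degree $k$, the ranks of the edges leaving $v$ are exactly $1,\dots,k$. A family is a directed $3$-cycle of $G$. A matching $\mathcal M$ is a set of pairwise vertex-disjoint families (possibly empty). For a vertex $v$, $R_{\mathcal M}(v)$ is the rank of the edge leaving $v$ within its family in $\mathcal M$, and $R_{\mathcal M}(v)=+\infty$ if $v$ belongs to no family of $\mathcal M$. A directed $3$-cycle $(v,v',v'')$ of $G$ is blocking for $\mathcal M$ if $r(v,v')<R_{\mathcal M}(v)$, $r(v',v'')<R_{\mathcal M}(v')$ and $r(v'',v)<R_{\mathcal M}(v'')$. A matching is stable if no blocking triple exists for it. -}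

module Defs where

open import Data.Nat using (ℕ; _≤_; _<_)
open import Data.Fin using (Fin; _≟_)
open import Data.Bool using (Bool; true; T)
open import Data.List using (List; []; _∷_; length; filter)
open import Data.List using (allFin)
open import Data.Unit using (⊤)
open import Data.List.Membership.Propositional using (_∈_)
open import Data.List.Relation.Unary.AllPairs using (AllPairs)
open import Data.Maybe using (Maybe; just; nothing)
open import Data.Product using (_×_; _,_; ∃)
open import Relation.Binary.PropositionalEquality using (_≡_; _≢_)
open import Relation.Nullary using (¬_; yes; no)
open import Relation.Nullary.Decidable using (T?)

data Part : Set where
  M F D : Part

next : Part → Part
next M = F
next F = D
next D = M

-- A vertex is a part together with an index in Fin n.
-- An instance of 3DSMI of dimension n.
record Instance (n : ℕ) : Set where
  field
    -- edge p i j : there is an edge from vertex i of part p to vertex j of part (next p)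
    -- (a relation, hence no multiple edges)
    edge : Part → Fin n → Fin n → Bool
    -- rank of that edge (meaningful only when the edge exists)
    rank : Part → Fin n → Fin n → ℕ

  outdeg : Part → Fin n → ℕ
  outdeg p i = length (filter (λ j → T? (edge p i j)) (allFin n))

  field
    rank-range : ∀ p i j → T (edge p i j) → 1 ≤ rank p i j × rank p i j ≤ outdeg p i
    rank-inj   : ∀ p i j j′ → T (edge p i j) → T (edge p i j′) →
                 rank p i j ≡ rank p i j′ → j ≡ j′
    rank-surj  : ∀ p i r → 1 ≤ r → r ≤ outdeg p i →
                 ∃ λ j → T (edge p i j) × rank p i j ≡ r

module _ {n : ℕ} (I : Instance n) where
  open Instance I

  Triple : Set
  Triple = Fin n × Fin n × Fin n

  comp : Part → Triple → Fin n
  comp M (m , f , d) = m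
  comp F (m , f , d) = f
  comp D (m , f , d) = d

  -- a family: a directed 3-cycle m → f → d → m of G
  -- (every directed 3-cycle of G is of this form up to rotation)
  IsFamily : Triple → Set
  IsFamily t = ∀ p → T (edge p (comp p t) (comp (next p) t))

  IsMatching : List Triple → Set
  IsMatching ms = (∀ t → t ∈ ms → IsFamily t) ×
                  AllPairs (λ t t′ → ∀ p → comp p t ≢ comp p t′) ms

  -- R_M(v) for v = vertex i of part p; nothing stands for +∞
  R : List Triple → Part → Fin n → Maybe ℕ
  R [] p i = nothing
  R (t ∷ ts) p i with comp p t ≟ i
  ... | yes _ = just (rank p i (comp (next p) t))
  ... | no _  = R ts p i

  _<∞_ : ℕ → Maybe ℕ → Set
  r <∞ nothing = ⊤
  r <∞ just k  = r < k

  Blocking : List Triple → Triple → Set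
  Blocking ms t = IsFamily t ×
    (∀ p → rank p (comp p t) (comp (next p) t) <∞ R ms p (comp p t))

  Stable : List Triple → Set
  Stable ms = ∀ t → ¬ Blocking ms t

module Submission where

-- In dimension 1 the only triple, when it is a family, is a stable matching on its own, since a
-- family never blocks a matching containing it. In dimension 2 every vertex has two possible
-- successors, so for stability it only matters which of them it accepts and in which order: one
-- of five preferences per vertex, 5⁶ profiles in all. A matching of dimension 2 is empty, one
-- family, or a family and its complementary triple; for every profile one of these is stable,
-- which is checked by evaluation and transfers to every instance realising the profile.

open import Defs
open import Data.Nat using (ℕ; _≤_; _<_; _<ᵇ_; z≤n; s≤s)
open import Data.Nat.Properties using (<⇒<ᵇ; <ᵇ⇒<; <-irrefl; <-asym)
open import Data.Bool using (Bool; true; false; _∧_; not; T; if_then_else_)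
open import Data.Bool.Properties using (T-≡; T-∧; T-not-≡)
open import Data.Unit using (tt)
open import Function using (_∘_)
open import Data.Empty using (⊥-elim)
open import Data.Fin using (Fin; zero; suc; _≟_; opposite)
open import Data.Maybe using (Maybe; just; nothing; maybe′)
import Data.Maybe as Maybe
open import Data.Product using (_×_; _,_; ∃; proj₁; proj₂)
open import Data.Bool.ListAction using (all; any)
open import Data.List using (List; []; _∷_; [_]; allFin; cartesianProduct; map; _++_)
open import Data.List.Membership.Propositional using (_∈_)
open import Data.List.Membership.Propositional.Properties using (∈-allFin; ∈-cartesianProduct⁺)
open import Data.List.Relation.Unary.Any using (here; there; satisfied)
open import Data.List.Relation.Unary.Any.Properties using (any⁻)
open import Data.List.Relation.Unary.All using ([]; _∷_)
import Data.List.Relation.Unary.All as All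
open import Data.List.Relation.Unary.All.Properties using (all⁺; all⁻)
open import Data.List.Relation.Unary.AllPairs using (AllPairs; []; _∷_)
open import Function.Bundles using (Equivalence)
open import Relation.Binary.PropositionalEquality using (_≡_; _≢_; refl; sym; trans; subst; subst₂; cong)
open import Relation.Nullary using (¬_; Dec; yes; no; does)
open import Relation.Nullary.Decidable using (T?)

HasStableMatching : {n : ℕ} → Instance n → Set
HasStableMatching I = ∃ λ (ms : List (Triple I)) → IsMatching I ms × Stable I ms

module _ {n : ℕ} (I : Instance n) where
  open Instance I

  family? : ∀ t → Dec (IsFamily I t)
  family? t with T? (edge M (comp I M t) (comp I F t))
               | T? (edge F (comp I F t) (comp I D t))
               | T? (edge D (comp I D t) (comp I M t))
  ... | yes eM | yes eF | yes eD = yes λ { M → eM ; F → eF ; D → eD }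
  ... | no ¬eM | _      | _      = no λ fam → ¬eM (fam M)
  ... | yes _  | no ¬eF | _      = no λ fam → ¬eF (fam F)
  ... | yes _  | yes _  | no ¬eD = no λ fam → ¬eD (fam D)

  []-isMatching : IsMatching I []
  []-isMatching = (λ _ ()) , []

  [-]-isMatching : ∀ {t} → IsFamily I t → IsMatching I [ t ]
  [-]-isMatching fam = (λ { _ (here refl) → fam }) , ([] ∷ [])

  []-stable : (∀ t → ¬ IsFamily I t) → Stable I []
  []-stable ¬fam t (fam , _) = ¬fam t fam

  R-head : ∀ t ts p → R I (t ∷ ts) p (comp I p t) ≡ just (rank p (comp I p t) (comp I (next p) t))
  R-head t ts p with comp I p t ≟ comp I p t
  ... | yes _ = refl
  ... | no ≢ = ⊥-elim (≢ refl)

  head-not-blocking : ∀ t ts → ¬ Blocking I (t ∷ ts) t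
  head-not-blocking t ts (_ , improves) = <-irrefl refl (subst (_<∞_ I _) (R-head t ts M) (improves M))

stableMatching₀ : (I : Instance 0) → HasStableMatching I
stableMatching₀ I = [] , []-isMatching I , λ { (() , _) _ }

stableMatching₁ : (I : Instance 1) → HasStableMatching I
stableMatching₁ I with family? I (zero , zero , zero)
... | yes fam = [ zero , zero , zero ] , [-]-isMatching I fam ,
                λ { (zero , zero , zero) → head-not-blocking I _ [] }
... | no ¬fam = [] , []-isMatching I , []-stable I λ { (zero , zero , zero) → ¬fam }

-- both j : both successors are acceptable and j is ranked first.
data Pref : Set where
  none : Pref
  only : Fin 2 → Pref
  both : Fin 2 → Pref

acceptsᵇ : Pref → Fin 2 → Bool
acceptsᵇ none     _ = false
acceptsᵇ (only j) k = does (j ≟ k)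
acceptsᵇ (both _) _ = true

prefersᵇ : Pref → Fin 2 → Fin 2 → Bool
prefersᵇ (both j) k k′ = does (j ≟ k) ∧ not (does (j ≟ k′))
prefersᵇ _        _ _  = false

classify : (Fin 2 → Bool) → Fin 2 → Pref
classify acc first with acc zero | acc (suc zero)
... | false | false = none
... | true  | false = only zero
... | false | true  = only (suc zero)
... | true  | true  = both first

acceptsᵇ-classify : ∀ acc first j → acceptsᵇ (classify acc first) j ≡ acc j
acceptsᵇ-classify acc first zero with acc zero | acc (suc zero)
... | false | false = refl
... | true  | false = refl
... | false | true  = refl
... | true  | true  = refl
acceptsᵇ-classify acc first (suc zero) with acc zero | acc (suc zero)
... | false | false = refl
... | true  | false = refl
... | false | true  = refl
... | true  | true  = refl

prefersᵇ-classify : ∀ acc j j′ → T (acc j) → T (acc j′) → j ≢ j′ → T (prefersᵇ (classify acc j) j j′)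
prefersᵇ-classify acc zero       zero       _ _ j≢j′ = ⊥-elim (j≢j′ refl)
prefersᵇ-classify acc (suc zero) (suc zero) _ _ j≢j′ = ⊥-elim (j≢j′ refl)
prefersᵇ-classify acc zero (suc zero) _ _ _ with acc zero | acc (suc zero)
... | true | true = tt
prefersᵇ-classify acc (suc zero) zero _ _ _ with acc zero | acc (suc zero)
... | true | true = tt

firstChoice : (Fin 2 → ℕ) → Fin 2
firstChoice r = if r zero <ᵇ r (suc zero) then zero else suc zero

firstChoice-minimal : ∀ r j j′ → r j < r j′ → firstChoice r ≡ j
firstChoice-minimal r zero       zero       lt = ⊥-elim (<-irrefl refl lt)
firstChoice-minimal r (suc zero) (suc zero) lt = ⊥-elim (<-irrefl refl lt)
firstChoice-minimal r zero (suc zero) lt with r zero <ᵇ r (suc zero) | <⇒<ᵇ lt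
... | true | _ = refl
firstChoice-minimal r (suc zero) zero lt with r zero <ᵇ r (suc zero) in eq
... | false = refl
... | true  = ⊥-elim (<-asym lt (<ᵇ⇒< _ _ (subst T (sym eq) tt)))

module _ (I : Instance 2) where
  open Instance I

  preferenceOf : Part → Fin 2 → Pref
  preferenceOf p i = classify (edge p i) (firstChoice (rank p i))

  prefersᵇ-preferenceOf : ∀ {p i j j′} → T (edge p i j) → T (edge p i j′) → rank p i j < rank p i j′ →
                          T (prefersᵇ (preferenceOf p i) j j′)
  prefersᵇ-preferenceOf {p} {i} {j} {j′} e e′ lt
    rewrite firstChoice-minimal (rank p i) j j′ lt =
    prefersᵇ-classify (edge p i) j j′ e e′ λ { refl → <-irrefl refl lt }

Triple₂ : Set
Triple₂ = Fin 2 × Fin 2 × Fin 2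

component : Part → Triple₂ → Fin 2
component M (m , f , d) = m
component F (m , f , d) = f
component D (m , f , d) = d

comp≡component : ∀ (I : Instance 2) p t → comp I p t ≡ component p t
comp≡component I M t = refl
comp≡component I F t = refl
comp≡component I D t = refl

complement : Triple₂ → Triple₂
complement (m , f , d) = opposite m , opposite f , opposite d

≢-opposite : ∀ (i : Fin 2) → i ≢ opposite i
≢-opposite zero       ()
≢-opposite (suc zero) ()

data Matching₂ : Set where
  ∅       : Matching₂
  single  : Triple₂ → Matching₂
  perfect : Triple₂ → Matching₂

families : Matching₂ → List Triple₂
families ∅           = []
families (single t)  = [ t ]
families (perfect t) = t ∷ complement t ∷ []

partner : List Triple₂ → Part → Fin 2 → Maybe (Fin 2)
partner []       p i = nothing
partner (t ∷ ts) p i = if does (component p t ≟ i) then just (component (next p) t) else partner ts p i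

module _ {A : Set} {xs : List A} (enumerates : ∀ x → x ∈ xs) (f : A → Bool) where

  all⇒∀ : T (all f xs) → ∀ x → T (f x)
  all⇒∀ h x = All.lookup (all⁺ f xs h) (enumerates x)

  all≡true⇒∀ : all f xs ≡ true → ∀ x → T (f x)
  all≡true⇒∀ h = all⇒∀ (Equivalence.from T-≡ h)

  ∀⇒all : (∀ x → T (f x)) → T (all f xs)
  ∀⇒all h = all⁻ f {xs = xs} (All.tabulate λ {x} _ → h x)

parts : List Part
parts = M ∷ F ∷ D ∷ []

∈-parts : ∀ p → p ∈ parts
∈-parts M = here refl
∈-parts F = there (here refl)
∈-parts D = there (there (here refl))

triples : List Triple₂
triples = cartesianProduct (allFin 2) (cartesianProduct (allFin 2) (allFin 2))

∈-triples : ∀ t → t ∈ triples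
∈-triples (m , f , d) = ∈-cartesianProduct⁺ (∈-allFin m) (∈-cartesianProduct⁺ (∈-allFin f) (∈-allFin d))

matchings : List Matching₂
matchings = ∅ ∷ map single triples ++ map perfect triples

module Check (P : Part → Fin 2 → Pref) where

  acceptsAt : Triple₂ → Part → Bool
  acceptsAt t p = acceptsᵇ (P p (component p t)) (component (next p) t)

  isFamilyᵇ : Triple₂ → Bool
  isFamilyᵇ t = all (acceptsAt t) parts

  improvesᵇ : List Triple₂ → Part → Fin 2 → Fin 2 → Bool
  improvesᵇ ms p i j = maybe′ (prefersᵇ (P p i) j) true (partner ms p i)

  improvesAt : List Triple₂ → Triple₂ → Part → Bool
  improvesAt ms t p = improvesᵇ ms p (component p t) (component (next p) t)

  isBlockingᵇ : List Triple₂ → Triple₂ → Bool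
  isBlockingᵇ ms t = isFamilyᵇ t ∧ all (improvesAt ms t) parts

  isStableᵇ : List Triple₂ → Bool
  isStableᵇ ms = all (not ∘ isBlockingᵇ ms) triples

  isStableMatchingᵇ : Matching₂ → Bool
  isStableMatchingᵇ c = all isFamilyᵇ (families c) ∧ isStableᵇ (families c)

module Soundness (I : Instance 2) (P : Part → Fin 2 → Pref) (P≡ : ∀ p i → P p i ≡ preferenceOf I p i) where
  open Instance I
  open Check P

  Families : List Triple₂ → Set
  Families ms = ∀ t → t ∈ ms → IsFamily I t

  edge-component : ∀ p t → T (edge p (comp I p t) (comp I (next p) t)) →
                   T (edge p (component p t) (component (next p) t))
  edge-component p t = subst₂ (λ i j → T (edge p i j)) (comp≡component I p t) (comp≡component I (next p) t)

  acceptsᵇ≡edge : ∀ p t → acceptsᵇ (P p (component p t)) (component (next p) t) ≡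
                          edge p (comp I p t) (comp I (next p) t)
  acceptsᵇ≡edge p t rewrite comp≡component I p t | comp≡component I (next p) t | P≡ p (component p t) =
    acceptsᵇ-classify (edge p (component p t)) _ (component (next p) t)

  isFamilyᵇ-sound : ∀ t → T (isFamilyᵇ t) → IsFamily I t
  isFamilyᵇ-sound t h p = subst T (acceptsᵇ≡edge p t) (all⇒∀ ∈-parts (acceptsAt t) h p)

  isFamilyᵇ-complete : ∀ t → IsFamily I t → T (isFamilyᵇ t)
  isFamilyᵇ-complete t fam = ∀⇒all ∈-parts (acceptsAt t) λ p → subst T (sym (acceptsᵇ≡edge p t)) (fam p)

  complement-disjoint : ∀ t p → comp I p t ≢ comp I p (complement t)
  complement-disjoint t M = ≢-opposite _
  complement-disjoint t F = ≢-opposite _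
  complement-disjoint t D = ≢-opposite _

  families-isMatching : ∀ c → T (all isFamilyᵇ (families c)) → IsMatching I (families c)
  families-isMatching c h = (λ t t∈ → isFamilyᵇ-sound t (All.lookup (all⁺ _ _ h) t∈)) , disjoint c
    where
    disjoint : ∀ c → AllPairs (λ t t′ → ∀ p → comp I p t ≢ comp I p t′) (families c)
    disjoint ∅           = []
    disjoint (single t)  = [] ∷ []
    disjoint (perfect t) = (complement-disjoint t ∷ []) ∷ [] ∷ []

  R≡partner : ∀ ms p i → R I ms p i ≡ Maybe.map (rank p i) (partner ms p i)
  R≡partner []       p i = refl
  R≡partner (t ∷ ts) p i with comp I p t ≟ i | component p t ≟ i
  ... | yes refl | yes _   = cong (λ j → just (rank p i j)) (comp≡component I (next p) t)
  ... | no _     | no _    = R≡partner ts p i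
  ... | yes refl | no ≢    = ⊥-elim (≢ (sym (comp≡component I p t)))
  ... | no ≢     | yes eq = ⊥-elim (≢ (trans (comp≡component I p t) eq))

  partner-edge : ∀ {ms} → Families ms → ∀ p i j → partner ms p i ≡ just j → T (edge p i j)
  partner-edge {t ∷ ts} fams p i j eq with component p t ≟ i
  partner-edge {t ∷ ts} fams p .(component p t) .(component (next p) t) refl | yes refl =
    edge-component p t (fams t (here refl) p)
  ... | no _ = partner-edge (λ t′ t′∈ → fams t′ (there t′∈)) p i j eq

  improvesᵇ-complete : ∀ {ms} → Families ms → ∀ p i j → T (edge p i j) → _<∞_ I (rank p i j) (R I ms p i) →
                       T (improvesᵇ ms p i j)
  improvesᵇ-complete {ms} fams p i j e lt rewrite R≡partner ms p i with partner ms p i in eq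
  ... | nothing = tt
  ... | just j′ rewrite P≡ p i = prefersᵇ-preferenceOf I e (partner-edge fams p i j′ eq) lt

  isBlockingᵇ-complete : ∀ {ms} → Families ms → ∀ t → Blocking I ms t → T (isBlockingᵇ ms t)
  isBlockingᵇ-complete {ms} fams t (fam , improves) =
    Equivalence.from T-∧ (isFamilyᵇ-complete t fam , ∀⇒all ∈-parts (improvesAt ms t) improves-everywhere)
    where
    improves-everywhere : ∀ p → T (improvesAt ms t p)
    improves-everywhere p = subst₂ (λ i j → T (improvesᵇ ms p i j)) (comp≡component I p t) (comp≡component I (next p) t)
                       (improvesᵇ-complete fams p _ _ (fam p) (improves p))

  isStableMatchingᵇ-sound : ∀ c → T (isStableMatchingᵇ c) → IsMatching I (families c) × Stable I (families c)
  isStableMatchingᵇ-sound c h = matching , stable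
    where
    families×stable : T (all isFamilyᵇ (families c)) × T (isStableᵇ (families c))
    families×stable = Equivalence.to (T-∧ {all isFamilyᵇ (families c)}) h

    matching : IsMatching I (families c)
    matching = families-isMatching c (proj₁ families×stable)

    stable : Stable I (families c)
    stable t blocking = subst T (Equivalence.to T-not-≡ not-blocking) (isBlockingᵇ-complete (proj₁ matching) t blocking)
      where
      not-blocking : T (not (isBlockingᵇ (families c) t))
      not-blocking = all⇒∀ ∈-triples (not ∘ isBlockingᵇ (families c)) (proj₂ families×stable) t

prefs : List Pref
prefs = none ∷ only zero ∷ only (suc zero) ∷ both zero ∷ both (suc zero) ∷ []

∈-prefs : ∀ x → x ∈ prefs
∈-prefs none           = here refl
∈-prefs (only zero)       = there (here refl)
∈-prefs (only (suc zero)) = there (there (here refl))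
∈-prefs (both zero)       = there (there (there (here refl)))
∈-prefs (both (suc zero)) = there (there (there (there (here refl))))

Profile : Set
Profile = (Pref × Pref) × (Pref × Pref) × (Pref × Pref)

profiles : List Profile
profiles = cartesianProduct pairs (cartesianProduct pairs pairs)
  where
  pairs : List (Pref × Pref)
  pairs = cartesianProduct prefs prefs

∈-profiles : ∀ π → π ∈ profiles
∈-profiles (m , f , d) = ∈-cartesianProduct⁺ (∈-pair m) (∈-cartesianProduct⁺ (∈-pair f) (∈-pair d))
  where
  ∈-pair : ∀ (xy : Pref × Pref) → xy ∈ cartesianProduct prefs prefs
  ∈-pair (x , y) = ∈-cartesianProduct⁺ (∈-prefs x) (∈-prefs y)

_⟨_,_⟩ : Profile → Part → Fin 2 → Pref
((a , b) , _) ⟨ M , zero ⟩     = a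
((a , b) , _) ⟨ M , suc zero ⟩ = b
(_ , (a , b) , _) ⟨ F , zero ⟩     = a
(_ , (a , b) , _) ⟨ F , suc zero ⟩ = b
(_ , _ , (a , b)) ⟨ D , zero ⟩     = a
(_ , _ , (a , b)) ⟨ D , suc zero ⟩ = b

tabulateProfile : (Part → Fin 2 → Pref) → Profile
tabulateProfile f = (f M zero , f M (suc zero)) , (f F zero , f F (suc zero)) , (f D zero , f D (suc zero))

⟨⟩-tabulateProfile : ∀ f p i → tabulateProfile f ⟨ p , i ⟩ ≡ f p i
⟨⟩-tabulateProfile f M zero       = refl
⟨⟩-tabulateProfile f M (suc zero) = refl
⟨⟩-tabulateProfile f F zero       = refl
⟨⟩-tabulateProfile f F (suc zero) = refl
⟨⟩-tabulateProfile f D zero       = refl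
⟨⟩-tabulateProfile f D (suc zero) = refl

hasStableMatchingᵇ : Profile → Bool
hasStableMatchingᵇ π = any (Check.isStableMatchingᵇ (π ⟨_,_⟩)) matchings

-- The exhaustive check, run by the type checker; stated as an equation, which Agda decides far
-- faster than it checks an inhabitant of T.
every-profile-hasStableMatching : all hasStableMatchingᵇ profiles ≡ true
every-profile-hasStableMatching = refl

-- With xs left implicit, solving it would make Agda evaluate the check again.
T-hasStableMatchingᵇ : ∀ π → T (hasStableMatchingᵇ π)
T-hasStableMatchingᵇ = all≡true⇒∀ {xs = profiles} ∈-profiles hasStableMatchingᵇ every-profile-hasStableMatching

stableMatchingᵇ-exists : ∀ π → ∃ λ c → T (Check.isStableMatchingᵇ (π ⟨_,_⟩) c)
stableMatchingᵇ-exists π = satisfied (any⁻ (Check.isStableMatchingᵇ (π ⟨_,_⟩)) matchings (T-hasStableMatchingᵇ π))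

stableMatching-fromProfile : ∀ (I : Instance 2) π → (∀ p i → π ⟨ p , i ⟩ ≡ preferenceOf I p i) → HasStableMatching I
stableMatching-fromProfile I π π≡I =
  let c , stable = stableMatchingᵇ-exists π in
  families c , Soundness.isStableMatchingᵇ-sound I (π ⟨_,_⟩) π≡I c stable

stableMatching₂ : (I : Instance 2) → HasStableMatching I
stableMatching₂ I = stableMatching-fromProfile I (tabulateProfile (preferenceOf I)) (⟨⟩-tabulateProfile (preferenceOf I))

theorem2 : (n : ℕ) → n ≤ 2 → (I : Instance n) →
           ∃ λ (ms : List (Triple I)) → IsMatching I ms × Stable I ms
theorem2 0 z≤n             = stableMatching₀
theorem2 1 (s≤s z≤n)       = stableMatching₁
theorem2 2 (s≤s (s≤s z≤n)) = stableMatching₂
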